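{- For a positive integer $k$, let $m_k$ denote the minimum order of a connected graph $G$ with $c(G)\geq k$. Then: (1) $m_k = O(k^2)$ as $k\to\infty$. (2) The following two statements are equivalent: (i) (Meyniel's conjecture) there is a constant $d>0$ such that every connected graph $G$ of order $n$ satisfies $c(G)\leq d\sqrt{n}$; (ii) $m_k=\Omega(k^2)$ as $k\to\infty$.
   Context: Cops and Robbers is played on a finite, connected, undirected graph $G$. Cops first each choose a starting vertex, then the robber does; thereafter players alternate rounds, cops first, each player moving to an adjacent vertex or staying put (several cops may share a vertex). The cops win if some cop eventually occupies the robber's vertex. The cop number $c(G)$ is the minimum number of cops that have a winning strategy. -}

module Defs where

open import Data.Nat using (ℕ; _≤_; _*_; suc)
open import Data.Fin using (Fin)
open import Data.Bool using (Bool; true)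
open import Data.Vec using (Vec)
open import Data.Vec.Membership.Propositional using (_∈_)
open import Data.Vec.Relation.Binary.Pointwise.Inductive using (Pointwise)
open import Data.Product using (Σ; ∃-syntax; _×_)
open import Data.Sum using (_⊎_)
open import Relation.Nullary using (¬_)
open import Relation.Binary.PropositionalEquality using (_≡_)
open import Relation.Binary.Construct.Closure.ReflexiveTransitive using (Star)

record Graph : Set where
  field
    order  : ℕ
    adj    : Fin order → Fin order → Bool
    adj-sym     : ∀ u v → adj u v ≡ true → adj v u ≡ true
    adj-irrefl  : ∀ v → ¬ (adj v v ≡ true)

open Graph public

Vertex : Graph → Set
Vertex G = Fin (order G)

Adj : (G : Graph) → Vertex G → Vertex G → Set
Adj G u v = adj G u v ≡ true

Connected : Graph → Set
Connected G = (1 ≤ order G) × (∀ (u v : Vertex G) → Star (Adj G) u v)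

Step : (G : Graph) → Vertex G → Vertex G → Set
Step G u v = (u ≡ v) ⊎ Adj G u v

CopMove : (G : Graph) {k : ℕ} → Vec (Vertex G) k → Vec (Vertex G) k → Set
CopMove G = Pointwise (Step G)

-- CopsWinFrom G cs r : in the position where the cops are at cs, the robber
-- is at r and it is the cops' turn, the cops can force capture in finitely
-- many rounds (inductive = well-founded strategy tree).
data CopsWinFrom (G : Graph) {k : ℕ} : Vec (Vertex G) k → Vertex G → Set where
  caught : ∀ {cs r} → r ∈ cs → CopsWinFrom G cs r
  move   : ∀ {cs r} (cs' : Vec (Vertex G) k) → CopMove G cs cs' →
           (r ∈ cs' ⊎ (∀ r' → Step G r r' → CopsWinFrom G cs' r')) →
           CopsWinFrom G cs r

CopsWin : Graph → ℕ → Set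
CopsWin G k = Σ (Vec (Vertex G) k) λ cs → ∀ (r : Vertex G) → CopsWinFrom G cs r

CopNumberAtLeast : Graph → ℕ → Set
CopNumberAtLeast G k = ∀ j → suc j ≤ k → ¬ CopsWin G j

CopNumberAtMost : Graph → ℕ → Set
CopNumberAtMost G j = ∃[ i ] (i ≤ j × CopsWin G i)

MinOrderAtMost : ℕ → ℕ → Set
MinOrderAtMost k x = ∃[ G ] (Connected G × CopNumberAtLeast G k × order G ≤ x)

-- x ≤ m_k (with the bound given as x ≤ C * m_k, i.e. x / C ≤ m_k):
-- every connected graph with c(G) ≥ k has x ≤ C * order.
ScaledMinOrderAtLeast : ℕ → ℕ → ℕ → Set
ScaledMinOrderAtLeast C k x = ∀ (G : Graph) → Connected G → CopNumberAtLeast G k → x ≤ C * order G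

-- Since c(G) is a natural number, c(G) ≤ d√n ⇔ c(G)² ≤ d² n, and ranging
-- over real d > 0 is equivalent to ranging over natural D = ⌈d²⌉.
Meyniel : Set
Meyniel = ∃[ D ] (∀ (G : Graph) → Connected G →
            ∃[ c ] (CopNumberAtMost G c × c * c ≤ D * order G))

-- (1) For a prime p, the incidence graph of the points and non-vertical lines of 𝔽ₚ²
-- has 2p² vertices, each with p neighbours, and no 3- or 4-cycles since two lines meet
-- at most once. A cop not at the robber's vertex v dominates at most one neighbour of v,
-- so against fewer than p cops the robber always has a safe move (Aigner–Fromme).
-- Chebyshev's method gives a prime in (k, 32k + 1] for large k, whence m_k ≤ 2(33k)².
-- (2) Meyniel's bound turns c(G) ≥ k into k² ≤ d² n; conversely, m_k ≥ k²/C applied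
-- to k = c(G) bounds c(G)² by C n. The latter needs c(G) to exist, i.e. the game on a
-- finite graph to be decidable: the positions from which the cops win within t rounds
-- increase with t and stabilise after at most as many rounds as there are positions.

module Submission where

open import Defs
open import Data.Nat
open import Data.Nat.Properties
open import Data.Nat.Divisibility
open import Data.Nat.DivMod using (_mod_; %-distribˡ-+; [m+kn]%n≡m%n; m%n%n≡m%n; m<n⇒m%n≡m)
open import Data.Nat.Primality
open import Data.Nat.Primality.Factorisation using (factorise)
open import Data.Nat.LCM using (lcm; m∣lcm[m,n]; n∣lcm[m,n]; lcm-least)
open import Data.Nat.Induction using (<-rec)
open import Data.Nat.Tactic.RingSolver using (solve-∀)
open import Data.Fin using (Fin; toℕ) renaming (zero to fzero; suc to fsuc; _≟_ to _≟ᶠ_)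
import Data.Fin.Properties as Fin
open import Data.Fin.Properties using (toℕ-fromℕ<; toℕ<n; toℕ-injective; +↔⊎; *↔×)
open import Data.Bool using (Bool; true; false)
import Data.Bool as Bool
open import Data.Bool.Properties using (T-≡)
open import Data.List as List using (List; []; _∷_)
open import Data.List.Relation.Unary.All using ([]; _∷_)
open import Data.List.Relation.Unary.Any as ListAny using (here; there)
open import Data.List.Membership.Propositional using () renaming (_∈_ to _∈ˡ_)
open import Data.List.Membership.Propositional.Properties using (∈-allFin; ∈-cartesianProductWith⁺)
open import Data.Vec using (Vec; []; _∷_; lookup; allFin)
open import Data.Vec.Relation.Unary.Any as Any using (Any; here; there; index)
open import Data.Vec.Relation.Unary.Any.Properties using (lookup-index)
open import Data.Vec.Membership.Propositional using (_∈_; _∉_)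
open import Data.Vec.Membership.Propositional.Properties using (∈-lookup; ∈-allFin⁺)
open import Data.Vec.Relation.Binary.Pointwise.Inductive using (_∷_; decidable)
open import Data.Product using (∃; ∃-syntax; _×_; _,_; proj₁; proj₂)
open import Data.Sum as Sum using (_⊎_; inj₁; inj₂; [_,_]′)
open import Data.Sum.Function.Propositional using (_⊎-↔_)
open import Data.Empty using (⊥; ⊥-elim)
open import Data.Unit using (tt)
open import Function using (id; _∘_)
open import Function.Bundles using (_⇔_; mk⇔; _↔_; Inverse; Equivalence)
open import Function.Properties.Inverse using (↔-trans)
open import Relation.Nullary using (¬_; Dec; yes; no; ¬?)
open import Relation.Nullary.Decidable using (toWitness; _×-dec_; _⊎-dec_; _→-dec_; decidable-stable)
open import Relation.Binary.PropositionalEquality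
open import Relation.Binary.Construct.Closure.ReflexiveTransitive using (Star; ε; _◅_; _◅◅_; reverse)

-- Binomial coefficients

-- Pascal's recursion rather than the library's n C k (defined by division),
-- so that the identities below are proved by induction.
binomial : ℕ → ℕ → ℕ
binomial n       zero    = 1
binomial zero    (suc k) = 0
binomial (suc n) (suc k) = binomial n k + binomial n (suc k)

binomial-1 : ∀ n → binomial n 1 ≡ n
binomial-1 zero    = refl
binomial-1 (suc n) = cong suc (binomial-1 n)

binomial>0 : ∀ {n k} → k ≤ n → 0 < binomial n k
binomial>0 {k = zero}        _         = z<s
binomial>0 {suc n} {suc k} (s≤s k≤n) = ≤-trans (binomial>0 k≤n) (m≤m+n _ _)

binomial≤2^ : ∀ n k → binomial n k ≤ 2 ^ n
binomial≤2^ n       zero    = m^n>0 2 n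
binomial≤2^ zero    (suc k) = z≤n
binomial≤2^ (suc n) (suc k) = begin
  binomial n k + binomial n (suc k) ≤⟨ +-mono-≤ (binomial≤2^ n k) (binomial≤2^ n (suc k)) ⟩
  2 ^ n + 2 ^ n                     ≡⟨ cong (2 ^ n +_) (sym (+-identityʳ _)) ⟩
  2 ^ suc n                         ∎
  where open ≤-Reasoning

binomial-monoˡ : ∀ n k → binomial n k ≤ binomial (suc n) k
binomial-monoˡ n zero    = ≤-refl
binomial-monoˡ n (suc k) = m≤n+m _ _

2^≤central-binomial : ∀ m → 2 ^ m ≤ binomial (m + m) m
2^≤central-binomial zero    = ≤-refl
2^≤central-binomial (suc m) rewrite +-suc m m = begin
  2 ^ m + (2 ^ m + 0)                         ≡⟨ cong (2 ^ m +_) (+-identityʳ _) ⟩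
  2 ^ m + 2 ^ m                               ≤⟨ +-mono-≤ (2^≤central-binomial m) (2^≤central-binomial m) ⟩
  binomial (m + m) m + binomial (m + m) m     ≤⟨ +-mono-≤ (binomial-monoˡ (m + m) m) (m≤m+n _ _) ⟩
  binomial (suc (m + m)) m + binomial (suc (m + m)) (suc m) ∎
  where open ≤-Reasoning

binomial-absorb : ∀ n k → suc k * binomial (suc n) (suc k) ≡ suc n * binomial n k
binomial-absorb zero    zero    = refl
binomial-absorb zero    (suc k) = *-zeroʳ (2 + k)
binomial-absorb (suc n) zero    = begin
  1 * (1 + binomial (suc n) 1) ≡⟨ *-identityˡ _ ⟩
  suc (binomial (suc n) 1)     ≡⟨ cong (suc ∘ suc) (binomial-1 n) ⟩
  2 + n                        ≡⟨ sym (*-identityʳ _) ⟩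
  (2 + n) * 1                  ∎
  where open ≡-Reasoning
binomial-absorb (suc n) (suc k) = begin
  (2 + k) * (c₁ + c₂)                       ≡⟨ distribute k c₁ c₂ ⟩
  c₁ + suc k * c₁ + (2 + k) * c₂            ≡⟨ cong₂ (λ x y → c₁ + x + y) (binomial-absorb n k) (binomial-absorb n (suc k)) ⟩
  c₁ + suc n * binomial n k + suc n * binomial n (suc k) ≡⟨ collect (binomial n k) (binomial n (suc k)) n ⟩
  (2 + n) * c₁                              ∎
  where
  open ≡-Reasoning
  c₁ c₂ : ℕ
  c₁ = binomial (suc n) (suc k)
  c₂ = binomial (suc n) (2 + k)
  distribute : ∀ k x y → (2 + k) * (x + y) ≡ x + suc k * x + (2 + k) * y
  distribute = solve-∀
  collect : ∀ x y n → (x + y) + suc n * x + suc n * y ≡ (2 + n) * (x + y)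
  collect = solve-∀

binomial-factorial : ∀ a b → binomial (a + b) a * (a ! * b !) ≡ (a + b) !
binomial-factorial zero    b = trans (+-identityʳ _) (*-identityˡ _)
binomial-factorial (suc a) b = begin
  binomial (suc (a + b)) (suc a) * (suc a * a ! * b !)  ≡⟨ regroup (binomial (suc (a + b)) (suc a)) a (a !) (b !) ⟩
  suc a * binomial (suc (a + b)) (suc a) * (a ! * b !)  ≡⟨ cong (_* (a ! * b !)) (binomial-absorb (a + b) a) ⟩
  suc (a + b) * binomial (a + b) a * (a ! * b !)        ≡⟨ *-assoc (suc (a + b)) (binomial (a + b) a) (a ! * b !) ⟩
  suc (a + b) * (binomial (a + b) a * (a ! * b !))      ≡⟨ cong (suc (a + b) *_) (binomial-factorial a b) ⟩
  suc (a + b) * (a + b) !                               ∎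
  where
  open ≡-Reasoning
  regroup : ∀ c a x y → c * (suc a * x * y) ≡ suc a * c * (x * y)
  regroup = solve-∀

-- Products over primes

prime>1 : ∀ {p} → Prime p → 1 < p
prime>1 {p} p-prime = nonTrivial⇒n>1 p {{prime⇒nonTrivial p-prime}}

prime>0 : ∀ {p} → Prime p → 0 < p
prime>0 p-prime = <-trans z<s (prime>1 p-prime)

prime∤0<n<p : ∀ {p n} → Prime p → 0 < n → n < p → p ∤ n
prime∤0<n<p {n = suc _} _ _ n<p p∣n = <⇒≱ n<p (∣⇒≤ p∣n)

prime∤1 : ∀ {p} → Prime p → p ∤ 1
prime∤1 p-prime = prime∤0<n<p p-prime z<s (prime>1 p-prime)

prime∤n! : ∀ {p} n → Prime p → n < p → p ∤ n !
prime∤n! zero    p-prime _   = prime∤1 p-prime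
prime∤n! (suc n) p-prime n<p p∣n! with euclidsLemma (suc n) (n !) p-prime p∣n!
... | inj₁ p∣n+1 = prime∤0<n<p p-prime z<s n<p p∣n+1
... | inj₂ p∣n!′ = prime∤n! n p-prime (<-trans (n<1+n n) n<p) p∣n!′

m∣n! : ∀ {m n} → 0 < m → m ≤ n → m ∣ n !
m∣n! {suc m} _ m≤n = ∣-trans (m∣m*n (m !)) (m≤n⇒m!∣n! m≤n)

onPrimes : (ℕ → ℕ) → ℕ → ℕ
onPrimes f x with prime? x
... | yes _ = f x
... | no  _ = 1

onPrimes-composite : ∀ f {x} → ¬ Prime x → onPrimes f x ≡ 1
onPrimes-composite f {x} ¬prime with prime? x
... | yes x-prime = ⊥-elim (¬prime x-prime)
... | no  _       = refl

-- primeProduct f a b = ∏ f p over the primes p with a < p ≤ a + b.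
primeProduct : (ℕ → ℕ) → ℕ → ℕ → ℕ
primeProduct f a zero    = 1
primeProduct f a (suc b) = onPrimes f (suc (a + b)) * primeProduct f a b

primeProduct>0 : ∀ f → (∀ p → Prime p → 0 < f p) → ∀ a b → 0 < primeProduct f a b
primeProduct>0 f f>0 a zero    = z<s
primeProduct>0 f f>0 a (suc b) = *-mono-≤ (factor>0 (suc (a + b))) (primeProduct>0 f f>0 a b)
  where
  factor>0 : ∀ x → 0 < onPrimes f x
  factor>0 x with prime? x
  ... | yes x-prime = f>0 x x-prime
  ... | no  _       = z<s

primeProduct-split : ∀ f a b → primeProduct f 0 (a + b) ≡ primeProduct f 0 a * primeProduct f a b
primeProduct-split f a zero    = trans (cong (primeProduct f 0) (+-identityʳ a)) (sym (*-identityʳ _))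
primeProduct-split f a (suc b) rewrite +-suc a b =
  trans (cong (onPrimes f (suc (a + b)) *_) (primeProduct-split f a b))
        (x∙yz≈y∙xz (onPrimes f (suc (a + b))) (primeProduct f 0 a) (primeProduct f a b))
  where
  x∙yz≈y∙xz : ∀ x y z → x * (y * z) ≡ y * (x * z)
  x∙yz≈y∙xz = solve-∀

primeProduct-cong : ∀ {f g} a b → (∀ x → a < x → f x ≡ g x) → primeProduct f a b ≡ primeProduct g a b
primeProduct-cong a zero    _   = refl
primeProduct-cong {f} {g} a (suc b) f≗g =
  cong₂ _*_ (factor (suc (a + b)) (f≗g _ (s≤s (m≤m+n a b)))) (primeProduct-cong a b f≗g)
  where
  factor : ∀ x → f x ≡ g x → onPrimes f x ≡ onPrimes g x
  factor x fx≡gx with prime? x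
  ... | yes _ = fx≡gx
  ... | no  _ = refl

primeProduct≤^ : ∀ f a b {c} → 0 < c → (∀ p → Prime p → p ≤ a + b → f p ≤ c) → primeProduct f a b ≤ c ^ b
primeProduct≤^ f a zero    _   _   = ≤-refl
primeProduct≤^ f a (suc b) {c} 0<c f≤c = *-mono-≤ factor (primeProduct≤^ f a b 0<c (λ p p-prime p≤ → f≤c p p-prime (≤-trans p≤ a+b≤)))
  where
  a+b≤ : a + b ≤ a + suc b
  a+b≤ = ≤-trans (n≤1+n (a + b)) (≤-reflexive (sym (+-suc a b)))
  factor : onPrimes f (suc (a + b)) ≤ c
  factor with prime? (suc (a + b))
  ... | yes p-prime = f≤c _ p-prime (≤-reflexive (sym (+-suc a b)))
  ... | no  _       = 0<c

primorial : ℕ → ℕ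
primorial = primeProduct id 0

primeProduct≤primorial : ∀ a b → primeProduct id a b ≤ primorial (a + b)
primeProduct≤primorial a b = begin
  primeProduct id a b                   ≤⟨ m≤n*m _ (primorial a) {{>-nonZero (primeProduct>0 id (λ _ → prime>0) 0 a)}} ⟩
  primorial a * primeProduct id a b     ≡⟨ sym (primeProduct-split id a b) ⟩
  primorial (a + b)                     ∎
  where open ≤-Reasoning

prime∤primeProduct : ∀ {q} a b → Prime q → a + b < q → q ∤ primeProduct id a b
prime∤primeProduct a zero    q-prime _    = prime∤1 q-prime
prime∤primeProduct {q} a (suc b) q-prime a+b<q q∣∏ with prime? (suc (a + b))
... | no _ = prime∤primeProduct a b q-prime (<-trans (≤-reflexive (sym (+-suc a b))) a+b<q) (subst (q ∣_) (*-identityˡ _) q∣∏)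
... | yes _ with euclidsLemma (suc (a + b)) (primeProduct id a b) q-prime q∣∏
...   | inj₁ q∣p = prime∤0<n<p q-prime z<s (subst (_< q) (+-suc a b) a+b<q) q∣p
...   | inj₂ q∣∏′ = prime∤primeProduct a b q-prime (<-trans (≤-reflexive (sym (+-suc a b))) a+b<q) q∣∏′

primeProduct∣ : ∀ a b {X} → (∀ p → Prime p → a < p → p ≤ a + b → p ∣ X) → primeProduct id a b ∣ X
primeProduct∣ a zero    _      = 1∣ _
primeProduct∣ a (suc b) {X} p∣X with primeProduct∣ a b (λ p p-prime a<p p≤ → p∣X p p-prime a<p (≤-trans p≤ a+b≤a+1+b))
  where a+b≤a+1+b = ≤-trans (n≤1+n _) (≤-reflexive (sym (+-suc a b)))
... | divides t X≡t∏ with prime? (suc (a + b))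
...   | no _ = divides t (trans X≡t∏ (cong (t *_) (sym (*-identityˡ _))))
...   | yes p-prime with euclidsLemma t (primeProduct id a b) p-prime
                      (subst (suc (a + b) ∣_) X≡t∏ (p∣X _ p-prime (s≤s (m≤m+n a b)) (≤-reflexive (sym (+-suc a b)))))
...     | inj₂ p∣∏ = ⊥-elim (prime∤primeProduct a b p-prime ≤-refl p∣∏)
...     | inj₁ (divides u t≡up) = divides u (trans X≡t∏ (trans (cong (_* primeProduct id a b) t≡up) (*-assoc u _ _)))

-- Every prime in (m + 1, 2m + 1] divides (2m + 1)! but neither (m + 1)! nor m!.
primeProduct∣binomial : ∀ m → primeProduct id (suc m) m ∣ binomial (suc m + m) (suc m)
primeProduct∣binomial m = primeProduct∣ (suc m) m λ p p-prime m+1<p p≤2m+1 →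
  let p∣product = subst (p ∣_) (sym (binomial-factorial (suc m) m))
                        (m∣n! (prime>0 p-prime) p≤2m+1)
  in [ id , (λ p∣factorials → ⊥-elim ([ prime∤n! (suc m) p-prime m+1<p
                                       , prime∤n! m p-prime (<-trans (n<1+n m) m+1<p) ]′
                                       (euclidsLemma _ _ p-prime p∣factorials))) ]′
     (euclidsLemma _ _ p-prime p∣product)

even-or-odd : ∀ n → ∃[ m ] (n ≡ m + m ⊎ n ≡ suc (m + m))
even-or-odd zero = 0 , inj₁ refl
even-or-odd (suc n) with even-or-odd n
... | m , inj₁ n≡2m   = m , inj₂ (cong suc n≡2m)
... | m , inj₂ n≡2m+1 = suc m , inj₁ (trans (cong suc n≡2m+1) (cong suc (sym (+-suc m m))))

even>2-¬prime : ∀ m → ¬ Prime (2 + m + (2 + m))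
even>2-¬prime m = composite⇒¬prime (composite {d = 2} 2<n (divides (2 + m) (twice m)))
  where
  2<n : 2 < 2 + m + (2 + m)
  2<n = s≤s (s≤s (≤-trans z<s (≤-reflexive (sym (+-suc m (suc m))))))
  twice : ∀ m → 2 + m + (2 + m) ≡ (2 + m) * 2
  twice = solve-∀

-- Erdős: primorial (2m + 1) = primorial (m + 1) · ∏_{m+1<p≤2m+1} p, and the last factor
-- divides binomial (2m + 1) (m + 1) ≤ 2^(2m + 1).
primorial≤8^ : ∀ n → primorial n ≤ 2 ^ (3 * n)
primorial≤8^ = <-rec _ bound
  where
  bound : ∀ n → (∀ {m} → m < n → primorial m ≤ 2 ^ (3 * m)) → primorial n ≤ 2 ^ (3 * n)
  bound n rec with even-or-odd n
  ... | zero , inj₁ refl = ≤-refl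
  ... | 1    , inj₁ refl = toWitness {a? = primorial 2 ≤? 2 ^ 6} tt
  ... | 2+ m , inj₁ refl = begin
    primorial (2 + m + (2 + m)) ≡⟨ cong primorial n≡1+n′ ⟩
    primorial (suc n′)          ≡⟨ cong (_* primorial n′) (onPrimes-composite id (subst (¬_ ∘ Prime) n≡1+n′ (even>2-¬prime m))) ⟩
    1 * primorial n′            ≡⟨ *-identityˡ _ ⟩
    primorial n′                ≤⟨ rec (≤-reflexive (sym n≡1+n′)) ⟩
    2 ^ (3 * n′)                ≤⟨ ^-monoʳ-≤ 2 (*-monoʳ-≤ 3 (n≤1+n n′)) ⟩
    2 ^ (3 * suc n′)            ≡⟨ cong (λ x → 2 ^ (3 * x)) (sym n≡1+n′) ⟩
    2 ^ (3 * (2 + m + (2 + m))) ∎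
    where
    open ≤-Reasoning
    n′ : ℕ
    n′ = 2 + m + suc m
    n≡1+n′ : 2 + m + (2 + m) ≡ suc n′
    n≡1+n′ = +-suc (2 + m) (suc m)
  ... | zero  , inj₂ refl = toWitness {a? = primorial 1 ≤? 2 ^ 3} tt
  ... | suc m , inj₂ refl = begin
    primorial (2 + m + suc m)                             ≡⟨ primeProduct-split id (2 + m) (suc m) ⟩
    primorial (2 + m) * primeProduct id (2 + m) (suc m)   ≤⟨ *-mono-≤ (rec (s≤s (s≤s (m≤n+m (suc m) m)))) middle-primes ⟩
    2 ^ (3 * (2 + m)) * 2 ^ (2 + m + suc m)               ≡⟨ sym (^-distribˡ-+-* 2 (3 * (2 + m)) (2 + m + suc m)) ⟩
    2 ^ (3 * (2 + m) + (2 + m + suc m))                   ≤⟨ ^-monoʳ-≤ 2 (≤-trans (m≤m+n _ m) (≤-reflexive (exponents m))) ⟩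
    2 ^ (3 * (2 + m + suc m))                             ∎
    where
    open ≤-Reasoning
    middle-primes : primeProduct id (2 + m) (suc m) ≤ 2 ^ (2 + m + suc m)
    middle-primes = ≤-trans (∣⇒≤ {{>-nonZero (binomial>0 (m≤m+n (2 + m) (suc m)))}} (primeProduct∣binomial (suc m)))
                            (binomial≤2^ (2 + m + suc m) (2 + m))
    exponents : ∀ m → 3 * (2 + m) + (2 + m + suc m) + m ≡ 3 * (2 + m + suc m)
    exponents = solve-∀

-- A prime between k and 32k + 1

lcmUpTo : ℕ → ℕ
lcmUpTo zero    = 1
lcmUpTo (suc n) = lcm (suc n) (lcmUpTo n)

∣lcmUpTo : ∀ {d} n → 0 < d → d ≤ n → d ∣ lcmUpTo n
∣lcmUpTo {suc _} zero    _   ()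
∣lcmUpTo (suc n) 0<d d≤1+n with m≤n⇒m<n∨m≡n d≤1+n
... | inj₂ refl      = m∣lcm[m,n] (suc n) (lcmUpTo n)
... | inj₁ (s≤s d≤n) = ∣-trans (∣lcmUpTo n 0<d d≤n) (n∣lcm[m,n] (suc n) (lcmUpTo n))

lcmUpTo-least : ∀ n {X} → (∀ d → 0 < d → d ≤ n → d ∣ X) → lcmUpTo n ∣ X
lcmUpTo-least zero    _   = 1∣ _
lcmUpTo-least (suc n) d∣X =
  lcm-least (d∣X (suc n) z<s ≤-refl) (lcmUpTo-least n (λ d 0<d d≤n → d∣X d 0<d (m≤n⇒m≤1+n d≤n)))

lcmUpTo>0 : ∀ n → 0 < lcmUpTo n
lcmUpTo>0 n with lcmUpTo n | lcmUpTo-least n (λ d → m∣n! {d} {n})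
... | zero  | 0∣n! = ⊥-elim (<⇒≢ (1≤n! n) (sym (0∣⇒≡0 0∣n!)))
... | suc _ | _    = z<s

-- 1/c = 1/a − 1/b, so L/c = L/a − L/b.
∣-harmonic : ∀ {a b c L} → 0 < a → 0 < b → a * b + c * a ≡ c * b → a ∣ L → b ∣ L → c ∣ L
∣-harmonic {a} {b} {c} {L} 0<a 0<b ab+ca≡cb (divides u L≡ua) (divides v L≡vb) =
  divides (u ∸ v) (begin
    L                   ≡⟨ sym (m+n∸m≡n (v * c) L) ⟩
    v * c + L ∸ v * c   ≡⟨ cong (_∸ v * c) (sym uc≡vc+L) ⟩
    u * c ∸ v * c       ≡⟨ sym (*-distribʳ-∸ c u v) ⟩
    (u ∸ v) * c         ∎)
  where
  open ≡-Reasoning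
  instance ab≢0 : NonZero (a * b)
  ab≢0 = >-nonZero (*-mono-≤ 0<a 0<b)
  e₁ : ∀ u a b c → u * c * (a * b) ≡ (u * a) * (c * b)
  e₁ = solve-∀
  e₂ : ∀ L a b c → L * (a * b + c * a) ≡ L * (c * a) + L * (a * b)
  e₂ = solve-∀
  e₃ : ∀ v a b c L → (v * b) * (c * a) + L * (a * b) ≡ (v * c + L) * (a * b)
  e₃ = solve-∀
  uc≡vc+L : u * c ≡ v * c + L
  uc≡vc+L = *-cancelʳ-≡ _ _ (a * b) (begin
    u * c * (a * b)                   ≡⟨ e₁ u a b c ⟩
    (u * a) * (c * b)                 ≡⟨ cong₂ _*_ (sym L≡ua) (sym ab+ca≡cb) ⟩
    L * (a * b + c * a)               ≡⟨ e₂ L a b c ⟩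
    L * (c * a) + L * (a * b)         ≡⟨ cong (λ x → x * (c * a) + L * (a * b)) L≡vb ⟩
    (v * b) * (c * a) + L * (a * b)   ≡⟨ e₃ v a b c L ⟩
    (v * c + L) * (a * b)             ∎)

-- The Leibniz harmonic triangle: with x = binomial n k, y = binomial (1+n) k,
-- z = binomial (1+n) (1+k), the numbers a = (1+n) x, b = (2+n) y, c = (2+n) z
-- satisfy 1/c = 1/a − 1/b.
leibniz-identity : ∀ k n x y z → suc k * z ≡ suc n * x → suc k * (y + z) ≡ (2 + n) * y →
                   (suc n * x) * ((2 + n) * y) + ((2 + n) * z) * (suc n * x) ≡ ((2 + n) * z) * ((2 + n) * y)
leibniz-identity k n x y z absorb₁ absorb₂ = *-cancelˡ-≡ _ _ (suc k) (begin
  suc k * (a * b + c * a)                        ≡⟨ e₁ k n x y z ⟩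
  (suc n * (2 + n) * x) * (suc k * (y + z))      ≡⟨ cong ((suc n * (2 + n) * x) *_) absorb₂ ⟩
  (suc n * (2 + n) * x) * ((2 + n) * y)          ≡⟨ e₂ n x y ⟩
  ((2 + n) * (2 + n) * y) * (suc n * x)          ≡⟨ cong (((2 + n) * (2 + n) * y) *_) (sym absorb₁) ⟩
  ((2 + n) * (2 + n) * y) * (suc k * z)          ≡⟨ e₃ k n y z ⟩
  suc k * (c * b)                                ∎)
  where
  open ≡-Reasoning
  a b c : ℕ
  a = suc n * x
  b = (2 + n) * y
  c = (2 + n) * z
  e₁ : ∀ k n x y z → suc k * ((suc n * x) * ((2 + n) * y) + ((2 + n) * z) * (suc n * x)) ≡ (suc n * (2 + n) * x) * (suc k * (y + z))
  e₁ = solve-∀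
  e₂ : ∀ n x y → (suc n * (2 + n) * x) * ((2 + n) * y) ≡ ((2 + n) * (2 + n) * y) * (suc n * x)
  e₂ = solve-∀
  e₃ : ∀ k n y z → ((2 + n) * (2 + n) * y) * (suc k * z) ≡ suc k * (((2 + n) * z) * ((2 + n) * y))
  e₃ = solve-∀

[1+n]*binomial∣lcmUpTo : ∀ k n → k ≤ n → suc n * binomial n k ∣ lcmUpTo (suc n)
[1+n]*binomial∣lcmUpTo zero    n       _         =
  subst (_∣ lcmUpTo (suc n)) (sym (*-identityʳ (suc n))) (∣lcmUpTo (suc n) z<s ≤-refl)
[1+n]*binomial∣lcmUpTo (suc k) (suc n) (s≤s k≤n) =
  ∣-harmonic (*-mono-≤ {1} {suc n} z<s (binomial>0 k≤n)) (*-mono-≤ {1} {2 + n} z<s (binomial>0 (m≤n⇒m≤1+n k≤n)))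
    (leibniz-identity k n (binomial n k) (binomial (suc n) k) (binomial (suc n) (suc k))
                      (binomial-absorb n k) (binomial-absorb (suc n) k))
    (∣-trans ([1+n]*binomial∣lcmUpTo k n k≤n) (n∣lcm[m,n] (2 + n) (lcmUpTo (suc n))))
    ([1+n]*binomial∣lcmUpTo k (suc n) (m≤n⇒m≤1+n k≤n))

2^≤lcmUpTo : ∀ m → 2 ^ m ≤ lcmUpTo (suc (m + m))
2^≤lcmUpTo m = begin
  2 ^ m                               ≤⟨ 2^≤central-binomial m ⟩
  binomial (m + m) m                  ≤⟨ m≤m+n (binomial (m + m) m) ((m + m) * binomial (m + m) m) ⟩
  suc (m + m) * binomial (m + m) m    ≤⟨ ∣⇒≤ {{>-nonZero (lcmUpTo>0 (suc (m + m)))}} ([1+n]*binomial∣lcmUpTo m (m + m) (m≤m+n m m)) ⟩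
  lcmUpTo (suc (m + m))               ∎
  where open ≤-Reasoning

prime-factor : ∀ {d} → 1 < d → ∃[ q ] (Prime q × q ∣ d)
prime-factor {d} 1<d with factorise d {{>-nonZero (<-trans z<s 1<d)}}
... | record { factors = [] ; isFactorisation = d≡1 } = ⊥-elim (<⇒≢ 1<d (sym d≡1))
... | record { factors = q ∷ _ ; isFactorisation = d≡∏ ; factorsPrime = q-prime ∷ _ } =
  q , q-prime , subst (q ∣_) (sym d≡∏) (m∣m*n _)

p-adic-split : ∀ {p} → Prime p → ∀ {d} → 0 < d → ∃[ a ] ∃[ r ] (d ≡ p ^ a * r × p ∤ r)
p-adic-split {p} p-prime {d} = <-rec (λ d → 0 < d → ∃[ a ] ∃[ r ] (d ≡ p ^ a * r × p ∤ r)) split d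
  where
  split : ∀ d → (∀ {e} → e < d → 0 < e → ∃[ a ] ∃[ r ] (e ≡ p ^ a * r × p ∤ r)) →
          0 < d → ∃[ a ] ∃[ r ] (d ≡ p ^ a * r × p ∤ r)
  split d rec 0<d with p ∣? d
  ... | no p∤d = 0 , d , sym (+-identityʳ d) , p∤d
  ... | yes (divides zero d≡0) = ⊥-elim (<⇒≢ 0<d (sym d≡0))
  ... | yes (divides e@(suc _) d≡ep) with rec (subst (e <_) (sym d≡ep) (m<m*n e p (prime>1 p-prime))) z<s
  ...   | a , r , e≡pᵃr , p∤r = suc a , r , trans d≡ep (trans (cong (_* p) e≡pᵃr) (regroup (p ^ a) r p)) , p∤r
    where
    regroup : ∀ x r p → x * r * p ≡ p * x * r
    regroup = solve-∀

-- Chebyshev's argument: if (n, 8n + 1] contained no prime, lcm (1, …, 8n + 1) ≥ 2^(4n)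
-- would divide ∏_{p ≤ n} p^(e p), where the prime powers p^(e p) ≤ 8n + 1 are at most
-- p^ℓ for the primes p ≤ s = 2^(j+2) and just p above s (as s² > 8n + 1); that product
-- is at most s^(ℓ s) · 8^n, too small once n = 4^j is large.
module PrimeAbove4^j (j : ℕ) (2≤j : 2 ≤ j)
                    (j-large : (2 + j) * ((3 + (j + j)) * 2 ^ (2 + j)) < 2 ^ (j + j)) where

  n m N s ℓ : ℕ
  n = 2 ^ (j + j)
  m = 4 * n
  N = suc (m + m)
  s = 2 ^ (2 + j)
  ℓ = 3 + (j + j)

  N<2^[1+ℓ] : N < 2 ^ suc ℓ
  N<2^[1+ℓ] = 1+8n<16n (m^n>0 2 (j + j))
    where
    1+8n<16n : ∀ {n} → 0 < n → suc (4 * n + 4 * n) < 2 * (2 * (2 * (2 * n)))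
    1+8n<16n {suc n} _ = ≤-trans (m≤m+n _ (8 * n + 6)) (≤-reflexive (sixteen n))
      where
      sixteen : ∀ n → suc (suc (4 * suc n + 4 * suc n)) + (8 * n + 6) ≡ 2 * (2 * (2 * (2 * suc n)))
      sixteen = solve-∀

  N<s*s : N < s * s
  N<s*s = subst (N <_) (trans (cong (2 ^_) (exponent j)) (^-distribˡ-+-* 2 (2 + j) (2 + j))) N<2^[1+ℓ]
    where
    exponent : ∀ j → 4 + (j + j) ≡ (2 + j) + (2 + j)
    exponent = solve-∀

  s≤n : s ≤ n
  s≤n = ^-monoʳ-≤ 2 (+-monoˡ-≤ j 2≤j)

  weight : ℕ → ℕ
  weight p with p ≤? s
  ... | yes _ = p ^ ℓ
  ... | no  _ = p

  weight>0 : ∀ p → Prime p → 0 < weight p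
  weight>0 p p-prime with p ≤? s
  ... | yes _ = m^n>0 p {{prime⇒nonZero p-prime}} ℓ
  ... | no  _ = prime>0 p-prime

  weight≤ : ∀ p → p ≤ s → weight p ≤ s ^ ℓ
  weight≤ p p≤s with p ≤? s
  ... | yes _   = ^-monoˡ-≤ ℓ p≤s
  ... | no  p≰s = ⊥-elim (p≰s p≤s)

  weight-large : ∀ p → s < p → weight p ≡ p
  weight-large p s<p with p ≤? s
  ... | yes p≤s = ⊥-elim (<⇒≱ s<p p≤s)
  ... | no  _   = refl

  prime-power∣weight : ∀ {p} a → Prime p → p ^ a ≤ N → p ^ a ∣ weight p
  prime-power∣weight {p} a p-prime pᵃ≤N with p ≤? s
  ... | yes _ = divides (p ^ (ℓ ∸ a)) (begin
    p ^ ℓ               ≡⟨ cong (p ^_) (sym (m+[n∸m]≡n a≤ℓ)) ⟩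
    p ^ (a + (ℓ ∸ a))   ≡⟨ ^-distribˡ-+-* p a (ℓ ∸ a) ⟩
    p ^ a * p ^ (ℓ ∸ a) ≡⟨ *-comm (p ^ a) _ ⟩
    p ^ (ℓ ∸ a) * p ^ a ∎)
    where
    open ≡-Reasoning
    a≤ℓ : a ≤ ℓ
    a≤ℓ = ≮⇒≥ λ ℓ<a → <⇒≱ N<2^[1+ℓ] (≤-trans (^-monoʳ-≤ 2 ℓ<a) (≤-trans (^-monoˡ-≤ a (prime>1 p-prime)) pᵃ≤N))
  ... | no p≰s with a
  ...   | zero   = 1∣ p
  ...   | suc zero = ∣-reflexive (*-identityʳ p)
  ...   | 2+ a′  = ⊥-elim (<⇒≱ N<s*s (≤-trans (<⇒≤ (*-mono-< s<p s<p)) (≤-trans p*p≤pᵃ pᵃ≤N)))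
    where
    s<p : s < p
    s<p = ≰⇒> p≰s
    p*p≤pᵃ : p * p ≤ p ^ (2 + a′)
    p*p≤pᵃ = *-monoʳ-≤ p (≤-trans (≤-reflexive (sym (*-identityʳ p)))
                                  (*-monoʳ-≤ p (m^n>0 p {{prime⇒nonZero p-prime}} a′)))

  Q : ℕ → ℕ
  Q = primeProduct weight 0

  smooth∣Q : ∀ t {d} → 0 < d → d ≤ N → (∀ q → Prime q → q ∣ d → q ≤ t) → d ∣ Q t
  smooth∣Q zero {suc zero} _ _ _ = ∣-refl
  smooth∣Q zero {2+ d} _ _ factors≤0 with prime-factor {2+ d} (s≤s z<s)
  ... | q , q-prime , q∣d = ⊥-elim (<⇒≱ (prime>1 q-prime) (≤-trans (factors≤0 q q-prime q∣d) z≤n))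
  smooth∣Q (suc t) {d} 0<d d≤N factors≤ with prime? (suc t)
  ... | no ¬prime = subst (d ∣_) (sym (*-identityˡ _)) (smooth∣Q t 0<d d≤N factors≤t)
    where
    factors≤t : ∀ q → Prime q → q ∣ d → q ≤ t
    factors≤t q q-prime q∣d with m≤n⇒m<n∨m≡n (factors≤ q q-prime q∣d)
    ... | inj₁ (s≤s q≤t) = q≤t
    ... | inj₂ refl      = ⊥-elim (¬prime q-prime)
  ... | yes p-prime with p-adic-split p-prime 0<d
  ...   | a , r , d≡pᵃr , p∤r =
    subst (_∣ weight (suc t) * Q t) (sym d≡pᵃr) (*-pres-∣ (prime-power∣weight a p-prime pᵃ≤N) (smooth∣Q t 0<r r≤N factors≤t))
    where
    instance d≢0 : NonZero d
    d≢0 = >-nonZero 0<d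
    r∣d : r ∣ d
    r∣d = subst (r ∣_) (sym d≡pᵃr) (n∣m*n (suc t ^ a))
    pᵃ≤N : suc t ^ a ≤ N
    pᵃ≤N = ≤-trans (∣⇒≤ (subst (suc t ^ a ∣_) (sym d≡pᵃr) (m∣m*n r))) d≤N
    r≤N : r ≤ N
    r≤N = ≤-trans (∣⇒≤ r∣d) d≤N
    0<r : 0 < r
    0<r = >-nonZero⁻¹ r {{m*n≢0⇒n≢0 (suc t ^ a) {{subst NonZero d≡pᵃr d≢0}}}}
    factors≤t : ∀ q → Prime q → q ∣ r → q ≤ t
    factors≤t q q-prime q∣r with m≤n⇒m<n∨m≡n (factors≤ q q-prime (∣-trans q∣r r∣d))
    ... | inj₁ (s≤s q≤t) = q≤t
    ... | inj₂ refl      = ⊥-elim (p∤r q∣r)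

  Q≤ : Q n ≤ 2 ^ ((2 + j) * (ℓ * s) + 3 * n)
  Q≤ = begin
    Q n                                              ≡⟨ cong Q (sym (m+[n∸m]≡n s≤n)) ⟩
    Q (s + (n ∸ s))                                  ≡⟨ primeProduct-split weight s (n ∸ s) ⟩
    Q s * primeProduct weight s (n ∸ s)              ≡⟨ cong (Q s *_) (primeProduct-cong s (n ∸ s) weight-large) ⟩
    Q s * primeProduct id s (n ∸ s)                  ≤⟨ *-mono-≤ Qs≤ (primeProduct≤primorial s (n ∸ s)) ⟩
    (s ^ ℓ) ^ s * primorial (s + (n ∸ s))            ≡⟨ cong₂ _*_ (^-*-assoc s ℓ s) (cong primorial (m+[n∸m]≡n s≤n)) ⟩
    s ^ (ℓ * s) * primorial n                        ≤⟨ *-monoʳ-≤ (s ^ (ℓ * s)) (primorial≤8^ n) ⟩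
    s ^ (ℓ * s) * 2 ^ (3 * n)                        ≡⟨ cong (_* 2 ^ (3 * n)) (^-*-assoc 2 (2 + j) (ℓ * s)) ⟩
    2 ^ ((2 + j) * (ℓ * s)) * 2 ^ (3 * n)            ≡⟨ sym (^-distribˡ-+-* 2 ((2 + j) * (ℓ * s)) (3 * n)) ⟩
    2 ^ ((2 + j) * (ℓ * s) + 3 * n)                  ∎
    where
    open ≤-Reasoning
    Qs≤ : Q s ≤ (s ^ ℓ) ^ s
    Qs≤ = primeProduct≤^ weight 0 s (m^n>0 s {{m^n≢0 2 (2 + j)}} ℓ) (λ p _ p≤s → weight≤ p p≤s)

  ¬prime-between⇒small : (∀ p → Prime p → n < p → p ≤ N → ⊥) → n ≤ (2 + j) * (ℓ * s)
  ¬prime-between⇒small none = +-cancelʳ-≤ (3 * n) n _ (subst (_≤ (2 + j) * (ℓ * s) + 3 * n) (split4 n) (^-cancelʳ-≤ chain))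
    where
    lcm∣Q : lcmUpTo N ∣ Q n
    lcm∣Q = lcmUpTo-least N λ d 0<d d≤N → smooth∣Q n 0<d d≤N λ q q-prime q∣d →
      ≮⇒≥ λ n<q → none q q-prime n<q (≤-trans (∣⇒≤ {{>-nonZero 0<d}} q∣d) d≤N)
    chain : 2 ^ m ≤ 2 ^ ((2 + j) * (ℓ * s) + 3 * n)
    chain = ≤-trans (2^≤lcmUpTo m) (≤-trans (∣⇒≤ {{>-nonZero (primeProduct>0 weight weight>0 0 n)}} lcm∣Q) Q≤)
    split4 : ∀ n → 4 * n ≡ n + 3 * n
    split4 = solve-∀
    ^-cancelʳ-≤ : ∀ {a b} → 2 ^ a ≤ 2 ^ b → a ≤ b
    ^-cancelʳ-≤ 2ᵃ≤2ᵇ = ≮⇒≥ λ b<a → <⇒≱ (^-monoʳ-< 2 (s≤s z<s) b<a) 2ᵃ≤2ᵇ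

  prime-between : ∃[ p ] (Prime p × n < p × p ≤ N)
  prime-between with anyUpTo? (λ p → (n <? p) ×-dec prime? p) (suc N)
  ... | yes (p , s≤s p≤N , n<p , p-prime) = p , p-prime , n<p , p≤N
  ... | no none = ⊥-elim (<⇒≱ j-large (¬prime-between⇒small λ p p-prime n<p p≤N → none (p , s≤s p≤N , n<p , p-prime)))

polynomial<2^[12+i] : ∀ i → 4 * ((2 + (i + 12)) * (3 + ((i + 12) + (i + 12)))) < 2 ^ (i + 12)
polynomial<2^[12+i] zero    = toWitness {a? = 4 * (14 * 27) <? 2 ^ 12} tt
polynomial<2^[12+i] (suc i) = ≤-<-trans (≤-trans (m≤m+n _ (8 * (i + 11) * (i + 11) + 28 * (i + 11) + 8)) (≤-reflexive (step i)))
                                  (*-monoʳ-< 2 (polynomial<2^[12+i] i))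
  where
  step : ∀ i → 4 * ((2 + suc (i + 12)) * (3 + (suc (i + 12) + suc (i + 12)))) + (8 * (i + 11) * (i + 11) + 28 * (i + 11) + 8)
             ≡ 2 * (4 * ((2 + (i + 12)) * (3 + ((i + 12) + (i + 12)))))
  step = solve-∀

[12+i]-large : ∀ i → let j = i + 12 in (2 + j) * ((3 + (j + j)) * 2 ^ (2 + j)) < 2 ^ (j + j)
[12+i]-large i = subst₂ _<_ (regroup j (2 ^ j)) (sym (^-distribˡ-+-* 2 j j))
                 (*-monoˡ-< (2 ^ j) {{m^n≢0 2 j}} (polynomial<2^[12+i] i))
  where
  j : ℕ
  j = i + 12
  regroup : ∀ j x → 4 * ((2 + j) * (3 + (j + j))) * x ≡ (2 + j) * ((3 + (j + j)) * (2 * (2 * x)))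
  regroup = solve-∀

4^[12+_] : ℕ → ℕ
4^[12+ i ] = 2 ^ ((i + 12) + (i + 12))

k≤4^[12+k] : ∀ k → k ≤ 4^[12+ k ]
k≤4^[12+k] k = ≤-trans (<⇒≤ (n<2^n k)) (^-monoʳ-≤ 2 (≤-trans (m≤m+n k 12) (m≤m+n _ _)))
  where
  n<2^n : ∀ n → n < 2 ^ n
  n<2^n zero    = z<s
  n<2^n (suc n) = ≤-<-trans (n<2^n n) (m<m+n (2 ^ n) (≤-trans (m^n>0 2 n) (m≤m+n _ 0)))

between-powers-of-4 : ∀ i k → 4^[12+ 0 ] ≤ k → k ≤ 4^[12+ i ] → ∃[ i′ ] (k ≤ 4^[12+ i′ ] × 4^[12+ i′ ] ≤ 4 * k)
between-powers-of-4 zero    k lo hi = 0 , hi , ≤-trans lo (m≤m+n k _)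
between-powers-of-4 (suc i) k lo hi with k ≤? 4^[12+ i ]
... | yes k≤ = between-powers-of-4 i k lo k≤
... | no  k≰ = suc i , hi , ≤-trans (≤-reflexive (quadruple i)) (*-monoʳ-≤ 4 (<⇒≤ (≰⇒> k≰)))
  where
  quadruple : ∀ i → 4^[12+ suc i ] ≡ 4 * 4^[12+ i ]
  quadruple i = trans (cong (2 ^_) (exponent i)) (times4 (4^[12+ i ]))
    where
    exponent : ∀ i → suc i + 12 + (suc i + 12) ≡ 2 + ((i + 12) + (i + 12))
    exponent = solve-∀
    times4 : ∀ x → 2 * (2 * x) ≡ 4 * x
    times4 = solve-∀

bertrand-weak : ∀ k → 2 ^ 24 ≤ k → ∃[ p ] (Prime p × k < p × p ≤ suc (32 * k))
bertrand-weak k 2²⁴≤k with between-powers-of-4 k k 2²⁴≤k (k≤4^[12+k] k)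
... | i , k≤4ʲ , 4ʲ≤4k = widen (PrimeAbove4^j.prime-between (i + 12) (≤-trans (s≤s (s≤s z≤n)) (m≤n+m 12 i)) ([12+i]-large i))
  where
  x : ℕ
  x = 4^[12+ i ]
  widen : ∃[ p ] (Prime p × x < p × p ≤ suc (4 * x + 4 * x)) → ∃[ p ] (Prime p × k < p × p ≤ suc (32 * k))
  widen (p , p-prime , x<p , p≤N) = p , p-prime , ≤-<-trans k≤4ʲ x<p , ≤-trans p≤N (s≤s (begin
    4 * x + 4 * x   ≡⟨ double x ⟩
    8 * x           ≤⟨ *-monoʳ-≤ 8 4ʲ≤4k ⟩
    8 * (4 * k)     ≡⟨ times32 k ⟩
    32 * k          ∎))
    where
    open ≤-Reasoning
    double : ∀ x → 4 * x + 4 * x ≡ 8 * x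
    double = solve-∀
    times32 : ∀ k → 8 * (4 * k) ≡ 32 * k
    times32 = solve-∀

-- A lower bound for the cop number

some-index-unclaimed : ∀ {V : Set} {j p} (cs : Vec V j) (R : Fin p → V → Set) → (∀ i c → Dec (R i c)) →
                       (∀ {i i′ c} → c ∈ cs → R i c → R i′ c → i ≡ i′) → j < p → ∃[ i ] ¬ Any (R i) cs
some-index-unclaimed {p = p} cs R R? claims-one j<p with Fin.all? (λ i → Any.any? (R? i) cs)
... | no ¬all = Fin.¬∀⟶∃¬ p _ (λ i → Any.any? (R? i) cs) ¬all
... | yes all with Fin.pigeonhole j<p (λ i → index (all i))
...   | i , i′ , i<i′ , same = ⊥-elim (Fin.<⇒≢ i<i′ (claims-one (∈-lookup (index (all i)) cs) (lookup-index (all i))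
                                        (subst (λ k → R i′ (lookup cs k)) (sym same) (lookup-index (all i′)))))

step? : ∀ G (u v : Vertex G) → Dec (Step G u v)
step? G u v = (u ≟ᶠ v) ⊎-dec (adj G u v Bool.≟ true)

record MinDegreeGirth5 (G : Graph) (p : ℕ) : Set where
  field
    neighbour           : Vertex G → Fin p → Vertex G
    neighbour-adj       : ∀ v i → Adj G v (neighbour v i)
    neighbour-injective : ∀ v {i i′} → neighbour v i ≡ neighbour v i′ → i ≡ i′
    no-triangle         : ∀ {u v w} → Adj G u v → Adj G v w → Adj G u w → ⊥
    no-4-cycle          : ∀ {u v y y′} → u ≢ v → y ≢ y′ → Adj G u y → Adj G u y′ → Adj G v y → Adj G v y′ → ⊥

module _ {G : Graph} {p : ℕ} (graph : MinDegreeGirth5 G p) where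
  open MinDegreeGirth5 graph

  Safe : ∀ {j} → Vec (Vertex G) j → Vertex G → Set
  Safe cs v = ¬ Any (λ c → Step G c v) cs

  dominates-one-neighbour : ∀ {r c y y′} → c ≢ r → Adj G r y → Adj G r y′ → Step G c y → Step G c y′ → y ≡ y′
  dominates-one-neighbour {r} {c} {y} {y′} c≢r r∼y r∼y′ c→y c→y′ with y ≟ᶠ y′
  ... | yes y≡y′ = y≡y′
  ... | no  y≢y′ = ⊥-elim (impossible c→y c→y′)
    where
    impossible : Step G c y → Step G c y′ → ⊥
    impossible (inj₁ refl) (inj₁ refl) = y≢y′ refl
    impossible (inj₁ refl) (inj₂ y∼y′) = no-triangle r∼y y∼y′ r∼y′
    impossible (inj₂ c∼y)  (inj₁ refl) = no-triangle r∼y′ c∼y r∼y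
    impossible (inj₂ c∼y)  (inj₂ c∼y′) = no-4-cycle c≢r y≢y′ c∼y c∼y′ r∼y r∼y′

  escape : ∀ {j} (cs : Vec (Vertex G) j) r → j < p → r ∉ cs → ∃[ i ] Safe cs (neighbour r i)
  escape cs r j<p r∉cs = some-index-unclaimed cs (λ i c → Step G c (neighbour r i)) (λ i c → step? G c (neighbour r i))
    claims-one j<p
    where
    claims-one : ∀ {i i′ c} → c ∈ cs → Step G c (neighbour r i) → Step G c (neighbour r i′) → i ≡ i′
    claims-one {i} {i′} c∈cs c→y c→y′ = neighbour-injective r
      (dominates-one-neighbour (λ { refl → r∉cs c∈cs }) (neighbour-adj r i) (neighbour-adj r i′) c→y c→y′)

  unoccupied-neighbour : ∀ {j} (cs : Vec (Vertex G) j) v → j < p → ∃[ i ] neighbour v i ∉ cs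
  unoccupied-neighbour cs v j<p = some-index-unclaimed cs (λ i c → neighbour v i ≡ c) (λ i c → neighbour v i ≟ᶠ c)
    (λ v∈cs yᵢ≡c yᵢ′≡c → neighbour-injective v (trans yᵢ≡c (sym yᵢ′≡c))) j<p

  caught⇒dominated : ∀ {j} {cs cs′ : Vec (Vertex G) j} {r} → CopMove G cs cs′ → r ∈ cs′ → Any (λ c → Step G c r) cs
  caught⇒dominated (c→c′ ∷ _)  (here refl) = here c→c′
  caught⇒dominated (_ ∷ moves) (there r∈)  = there (caught⇒dominated moves r∈)

  robber-evades : ∀ {j} {cs : Vec (Vertex G) j} {r} → j < p → Safe cs r → ¬ CopsWinFrom G cs r
  robber-evades j<p safe (caught r∈cs)              = safe (Any.map (λ c≡r → inj₁ (sym c≡r)) r∈cs)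
  robber-evades j<p safe (move cs′ moves (inj₁ r∈cs′)) = safe (caught⇒dominated moves r∈cs′)
  robber-evades {r = r} j<p safe (move cs′ moves (inj₂ win)) with escape cs′ r j<p (safe ∘ caught⇒dominated moves)
  ... | i , safe′ = robber-evades j<p safe′ (win (neighbour r i) (inj₂ (neighbour-adj r i)))

  -- The robber starts at a neighbour of an unoccupied neighbour of v that no cop dominates.
  cop-number≥ : Vertex G → ∀ k → k ≤ p → CopNumberAtLeast G k
  cop-number≥ v k k≤p j j<k (cs , win) = robber-evades j<p safe (win start)
    where
    j<p : j < p
    j<p = <-≤-trans j<k k≤p
    y : Vertex G
    y = neighbour v (proj₁ (unoccupied-neighbour cs v j<p))
    escape-from-y : ∃[ i ] Safe cs (neighbour y i)
    escape-from-y = escape cs y j<p (proj₂ (unoccupied-neighbour cs v j<p))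
    start : Vertex G
    start = neighbour y (proj₁ escape-from-y)
    safe : Safe cs start
    safe = proj₂ escape-from-y

-- The affine plane over 𝔽ₚ

module Modular (q : ℕ) (p-prime : Prime (suc q)) where

  p : ℕ
  p = suc q

  infix 4 _≈_
  _≈_ : ℕ → ℕ → Set
  m ≈ n = m % p ≡ n % p

  +-cong-≈ : ∀ {a b c d} → a ≈ b → c ≈ d → a + c ≈ b + d
  +-cong-≈ {a} {b} {c} {d} a≈b c≈d =
    trans (%-distribˡ-+ a c p) (trans (cong₂ (λ x y → (x + y) % p) a≈b c≈d) (sym (%-distribˡ-+ b d p)))

  -- adding q c = (p − 1) c to both sides cancels c
  +-cancelˡ-≈ : ∀ c {u v} → c + u ≈ c + v → u ≈ v
  +-cancelˡ-≈ c {u} {v} c+u≈c+v = begin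
    u % p                 ≡⟨ sym ([m+kn]%n≡m%n u c p) ⟩
    (u + c * p) % p       ≡⟨ cong (_% p) (regroup u c q) ⟩
    (q * c + (c + u)) % p ≡⟨ +-cong-≈ {q * c} {q * c} {c + u} {c + v} refl c+u≈c+v ⟩
    (q * c + (c + v)) % p ≡⟨ cong (_% p) (sym (regroup v c q)) ⟩
    (v + c * p) % p       ≡⟨ [m+kn]%n≡m%n v c p ⟩
    v % p                 ∎
    where
    open ≡-Reasoning
    regroup : ∀ u c q → u + c * suc q ≡ q * c + (c + u)
    regroup = solve-∀

  ≈⇒≡ : ∀ {m n} → m < p → n < p → m ≈ n → m ≡ n
  ≈⇒≡ m<p n<p m≈n = trans (sym (m<n⇒m%n≡m m<p)) (trans m≈n (m<n⇒m%n≡m n<p))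

  *≈0⇒ : ∀ d e → d < p → e < p → d * e ≈ 0 → d ≡ 0 ⊎ e ≡ 0
  *≈0⇒ d e d<p e<p de≈0 = Sum.map (≈⇒≡ d<p z<s ∘ n∣m⇒m%n≡0 d p) (≈⇒≡ e<p z<s ∘ n∣m⇒m%n≡0 e p)
    (euclidsLemma d e p-prime (m%n≡0⇒n∣m (d * e) p de≈0))

  ordered-cross≈⇒ : ∀ {a a′ x x′} → a′ ≤ a → x′ ≤ x → a < p → x < p →
                    a * x + a′ * x′ ≈ a′ * x + a * x′ → a ≡ a′ ⊎ x ≡ x′
  ordered-cross≈⇒ {a′ = a′} {x′ = x′} a′≤a x′≤x a<p x<p cross with m≤n⇒∃[o]m+o≡n a′≤a | m≤n⇒∃[o]m+o≡n x′≤x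
  ... | d , refl | e , refl = Sum.map (drop a′) (drop x′) (*≈0⇒ d e (≤-<-trans (m≤n+m d a′) a<p) (≤-<-trans (m≤n+m e x′) x<p) de≈0)
    where
    drop : ∀ m {n} → n ≡ 0 → m + n ≡ m
    drop m refl = +-identityʳ m
    rest : ℕ
    rest = a′ * (x′ + e) + (a′ + d) * x′
    expand : ∀ a′ d x′ e → (a′ + d) * (x′ + e) + a′ * x′ ≡ a′ * (x′ + e) + (a′ + d) * x′ + d * e
    expand = solve-∀
    de≈0 : d * e ≈ 0
    de≈0 = +-cancelˡ-≈ rest (trans (cong (_% p) (sym (expand a′ d x′ e))) (trans cross (cong (_% p) (sym (+-identityʳ rest)))))

  +-comm-≈ : ∀ a b c d → a + b ≈ c + d → b + a ≈ d + c
  +-comm-≈ a b c d = subst₂ _≈_ (+-comm a b) (+-comm c d)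

  -- The hypothesis says (a − a′)(x − x′) ≡ 0 (mod p), with the subtractions moved across.
  cross≈⇒ : ∀ {a a′ x x′} → a < p → a′ < p → x < p → x′ < p → a * x + a′ * x′ ≈ a′ * x + a * x′ → a ≡ a′ ⊎ x ≡ x′
  cross≈⇒ {a} {a′} {x} {x′} a<p a′<p x<p x′<p cross with ≤-total a′ a | ≤-total x′ x
  ... | inj₁ a′≤a | inj₁ x′≤x = ordered-cross≈⇒ a′≤a x′≤x a<p x<p cross
  ... | inj₂ a≤a′ | inj₂ x≤x′ = Sum.map sym sym (ordered-cross≈⇒ a≤a′ x≤x′ a′<p x′<p (+-comm-≈ (a * x) (a′ * x′) (a′ * x) (a * x′) cross))
  ... | inj₁ a′≤a | inj₂ x≤x′ = Sum.map id sym (ordered-cross≈⇒ a′≤a x≤x′ a<p x′<p (+-comm-≈ (a′ * x) (a * x′) (a * x) (a′ * x′) (sym cross)))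
  ... | inj₂ a≤a′ | inj₁ x′≤x = Sum.map sym id (ordered-cross≈⇒ a≤a′ x′≤x a′<p x<p (sym cross))

module AffinePlane (q : ℕ) (p-prime : Prime (suc q)) where
  open Modular q p-prime

  OnLine : (x y a b : Fin p) → Set
  OnLine x y a b = (toℕ a * toℕ x + toℕ b) % p ≡ toℕ y

  lines-meet-once : ∀ {x y x′ y′ a b a′ b′} → OnLine x y a b → OnLine x y a′ b′ → OnLine x′ y′ a b → OnLine x′ y′ a′ b′ →
                    (x ≡ x′ × y ≡ y′) ⊎ (a ≡ a′ × b ≡ b′)
  lines-meet-once {x} {y} {x′} {y′} {a} {b} {a′} {b′} xy∈ab xy∈a′b′ x′y′∈ab x′y′∈a′b′
    with cross≈⇒ (toℕ<n a) (toℕ<n a′) (toℕ<n x) (toℕ<n x′) cross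
    where
    A A′ B B′ X X′ : ℕ
    A = toℕ a ; A′ = toℕ a′ ; B = toℕ b ; B′ = toℕ b′ ; X = toℕ x ; X′ = toℕ x′
    sum : (A * X + B) + (A′ * X′ + B′) ≈ (A′ * X + B′) + (A * X′ + B)
    sum = +-cong-≈ {A * X + B} {A′ * X + B′} {A′ * X′ + B′} {A * X′ + B}
                   (trans xy∈ab (sym xy∈a′b′)) (trans x′y′∈a′b′ (sym x′y′∈ab))
    regroup : ∀ a x b a′ x′ b′ → (a * x + b) + (a′ * x′ + b′) ≡ (b + b′) + (a * x + a′ * x′)
    regroup = solve-∀
    regroup′ : ∀ a x b a′ x′ b′ → (a′ * x + b′) + (a * x′ + b) ≡ (b + b′) + (a′ * x + a * x′)
    regroup′ = solve-∀
    cross : A * X + A′ * X′ ≈ A′ * X + A * X′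
    cross = +-cancelˡ-≈ (B + B′) (trans (cong (_% p) (sym (regroup A X B A′ X′ B′)))
                                   (trans sum (cong (_% p) (regroup′ A X B A′ X′ B′))))
  ... | inj₂ X≡X′ with toℕ-injective X≡X′
  ...   | refl = inj₁ (refl , toℕ-injective (trans (sym xy∈ab) x′y′∈ab))
  lines-meet-once {x} {a = a} {b} {b′ = b′} xy∈ab xy∈a′b′ _ _ | inj₁ A≡A′ with toℕ-injective A≡A′
  ... | refl = inj₂ (refl , toℕ-injective (≈⇒≡ (toℕ<n b) (toℕ<n b′)
                                              (+-cancelˡ-≈ (toℕ a * toℕ x) {toℕ b} {toℕ b′} (trans xy∈ab (sym xy∈a′b′)))))

  PlaneVertex : Set
  PlaneVertex = (Fin p × Fin p) ⊎ (Fin p × Fin p)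

  pattern point x y = inj₁ (x , y)
  pattern line a b  = inj₂ (a , b)

  incident : PlaneVertex → PlaneVertex → Bool
  incident (point x y) (line a b)  = (toℕ a * toℕ x + toℕ b) % p ≡ᵇ toℕ y
  incident (line a b)  (point x y) = (toℕ a * toℕ x + toℕ b) % p ≡ᵇ toℕ y
  incident (point _ _) (point _ _) = false
  incident (line _ _)  (line _ _)  = false

  Incident : PlaneVertex → PlaneVertex → Set
  Incident u v = incident u v ≡ true

  incident-sym : ∀ u v → incident u v ≡ incident v u
  incident-sym (point _ _) (point _ _) = refl
  incident-sym (point _ _) (line _ _)  = refl
  incident-sym (line _ _)  (point _ _) = refl
  incident-sym (line _ _)  (line _ _)  = refl

  on-line⇒incident : ∀ x y a b → OnLine x y a b → Incident (point x y) (line a b)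
  on-line⇒incident _ _ _ _ on = Equivalence.to T-≡ (≡⇒≡ᵇ _ _ on)

  incident⇒on-line : ∀ x y a b → Incident (point x y) (line a b) → OnLine x y a b
  incident⇒on-line _ _ _ _ inc = ≡ᵇ⇒≡ _ _ (Equivalence.from T-≡ inc)

  bipartite : ∀ {u v w} → Incident u v → Incident v w → Incident u w → ⊥
  bipartite {point _ _} {point _ _} ()
  bipartite {line _ _}  {line _ _}  ()
  bipartite {point _ _} {line _ _}  {point _ _} _ _ ()
  bipartite {point _ _} {line _ _}  {line _ _}  _ ()
  bipartite {line _ _}  {point _ _} {point _ _} _ ()
  bipartite {line _ _}  {point _ _} {line _ _}  _ _ ()

  no-4-cycle : ∀ {u v y y′} → u ≢ v → y ≢ y′ → Incident u y → Incident u y′ → Incident v y → Incident v y′ → ⊥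
  no-4-cycle {point x y} {point x′ y′} {line a b} {line a′ b′} u≢v y≢y′ u∼y u∼y′ v∼y v∼y′
    with lines-meet-once {x} {y} {x′} {y′} {a} {b} {a′} {b′}
                         (incident⇒on-line x y a b u∼y) (incident⇒on-line x y a′ b′ u∼y′)
                         (incident⇒on-line x′ y′ a b v∼y) (incident⇒on-line x′ y′ a′ b′ v∼y′)
  ... | inj₁ (refl , refl) = u≢v refl
  ... | inj₂ (refl , refl) = y≢y′ refl
  no-4-cycle {line a b} {line a′ b′} {point x y} {point x′ y′} u≢v y≢y′ u∼y u∼y′ v∼y v∼y′
    with lines-meet-once {x} {y} {x′} {y′} {a} {b} {a′} {b′}
                         (incident⇒on-line x y a b u∼y) (incident⇒on-line x y a′ b′ v∼y)
                         (incident⇒on-line x′ y′ a b u∼y′) (incident⇒on-line x′ y′ a′ b′ v∼y′)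
  ... | inj₁ (refl , refl) = y≢y′ refl
  ... | inj₂ (refl , refl) = u≢v refl
  no-4-cycle {point _ _} {_}         {point _ _} _ _ ()
  no-4-cycle {point _ _} {_}         {line _ _}  {point _ _} _ _ _ ()
  no-4-cycle {point _ _} {line _ _}  {line _ _}  {line _ _}  _ _ _ _ ()
  no-4-cycle {line _ _}  {_}         {line _ _}  _ _ ()
  no-4-cycle {line _ _}  {_}         {point _ _} {line _ _}  _ _ _ ()
  no-4-cycle {line _ _}  {point _ _} {point _ _} {point _ _} _ _ _ _ ()

  -- The line of slope a through (x, y) has intercept y − a x ≡ y + q a x (mod p).
  neighbour : PlaneVertex → Fin p → PlaneVertex
  neighbour (point x y) a = line a ((toℕ y + q * (toℕ a * toℕ x)) mod p)
  neighbour (line a b)  x = point x ((toℕ a * toℕ x + toℕ b) mod p)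

  neighbour-incident : ∀ v i → Incident v (neighbour v i)
  neighbour-incident (line a b)  x = on-line⇒incident x _ a b (sym (toℕ-fromℕ< _))
  neighbour-incident (point x y) a = on-line⇒incident x y a _ (begin
    (ax + toℕ ((toℕ y + q * ax) mod p)) % p ≡⟨ cong (λ z → (ax + z) % p) (toℕ-fromℕ< _) ⟩
    (ax + (toℕ y + q * ax) % p) % p         ≡⟨ [m+n%p]%p≡[m+n]%p ax (toℕ y + q * ax) ⟩
    (ax + (toℕ y + q * ax)) % p             ≡⟨ cong (_% p) (regroup ax (toℕ y) q) ⟩
    (toℕ y + ax * p) % p                    ≡⟨ [m+kn]%n≡m%n (toℕ y) ax p ⟩
    toℕ y % p                               ≡⟨ m<n⇒m%n≡m (toℕ<n y) ⟩
    toℕ y                                   ∎)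
    where
    open ≡-Reasoning
    ax : ℕ
    ax = toℕ a * toℕ x
    regroup : ∀ u y q → u + (y + q * u) ≡ y + u * suc q
    regroup = solve-∀
    [m+n%p]%p≡[m+n]%p : ∀ u v → (u + v % p) % p ≡ (u + v) % p
    [m+n%p]%p≡[m+n]%p u v = trans (%-distribˡ-+ u (v % p) p)
                             (trans (cong (λ z → (u % p + z) % p) (m%n%n≡m%n v p)) (sym (%-distribˡ-+ u v p)))

  neighbour-injective : ∀ v {i i′} → neighbour v i ≡ neighbour v i′ → i ≡ i′
  neighbour-injective (point _ _) refl = refl
  neighbour-injective (line _ _)  refl = refl

  vertices : Fin (p * p + p * p) ↔ PlaneVertex
  vertices = ↔-trans +↔⊎ (*↔× ⊎-↔ *↔×)

  open Inverse vertices using (to; from; strictlyInverseˡ; strictlyInverseʳ)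

  plane : Graph
  plane = record
    { order      = p * p + p * p
    ; adj        = λ u v → incident (to u) (to v)
    ; adj-sym    = λ u v u∼v → trans (incident-sym (to v) (to u)) u∼v
    ; adj-irrefl = λ v v∼v → bipartite {to v} {to v} {to v} v∼v v∼v v∼v
    }

  to-injective : ∀ {u v} → to u ≡ to v → u ≡ v
  to-injective {u} {v} eq = trans (sym (strictlyInverseʳ u)) (trans (cong from eq) (strictlyInverseʳ v))

  plane-minDegreeGirth5 : MinDegreeGirth5 plane p
  plane-minDegreeGirth5 = record
    { neighbour           = λ v i → from (neighbour (to v) i)
    ; neighbour-adj       = λ v i → subst (Incident (to v)) (sym (strictlyInverseˡ _)) (neighbour-incident (to v) i)
    ; neighbour-injective = λ v eq → neighbour-injective (to v) (trans (sym (strictlyInverseˡ _)) (trans (cong to eq) (strictlyInverseˡ _)))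
    ; no-triangle         = λ {u} {v} {w} → bipartite {to u} {to v} {to w}
    ; no-4-cycle          = λ {u} {v} {y} {y′} u≢v y≢y′ → no-4-cycle {to u} {to v} {to y} {to y′} (u≢v ∘ to-injective) (y≢y′ ∘ to-injective)
    }

  origin : Vertex plane
  origin = from (point fzero fzero)

  Walk : PlaneVertex → PlaneVertex → Set
  Walk u v = Star (Adj plane) (from u) (from v)

  edge : ∀ u v → Incident u v → Walk u v
  edge u v u∼v = subst₂ Incident (sym (strictlyInverseˡ u)) (sym (strictlyInverseˡ v)) u∼v ◅ ε

  one : Fin p
  one = 1 mod p

  toℕ-one : toℕ one ≡ 1
  toℕ-one = trans (toℕ-fromℕ< _) (m<n⇒m%n≡m (prime>1 p-prime))

  -- (x, y) lies on the horizontal line through (y, y), which lies on the diagonal through (0, 0).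
  walk-to-origin : ∀ v → Walk v (point fzero fzero)
  walk-to-origin (point x y) =
    edge (point x y) (line fzero y) (on-line⇒incident x y fzero y (m<n⇒m%n≡m (toℕ<n y))) ◅◅
    edge (line fzero y) (point y y) (on-line⇒incident y y fzero y (m<n⇒m%n≡m (toℕ<n y))) ◅◅
    edge (point y y) (line one fzero) (on-line⇒incident y y one fzero (begin
      (toℕ one * toℕ y + 0) % p ≡⟨ cong (λ c → (c * toℕ y + 0) % p) toℕ-one ⟩
      (1 * toℕ y + 0) % p       ≡⟨ cong (_% p) (trans (+-identityʳ (1 * toℕ y)) (*-identityˡ (toℕ y))) ⟩
      toℕ y % p                 ≡⟨ m<n⇒m%n≡m (toℕ<n y) ⟩
      toℕ y                     ∎)) ◅◅
    edge (line one fzero) (point fzero fzero)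
      (on-line⇒incident fzero fzero one fzero (cong (λ z → (z + 0) % p) (*-zeroʳ (toℕ one))))
    where open ≡-Reasoning
  walk-to-origin (line a b) =
    edge (line a b) (point fzero b)
      (on-line⇒incident fzero b a b (trans (cong (λ z → (z + toℕ b) % p) (*-zeroʳ (toℕ a))) (m<n⇒m%n≡m (toℕ<n b))))
    ◅◅ walk-to-origin (point fzero b)

  plane-connected : Connected plane
  plane-connected = s≤s z≤n , λ u v →
    subst₂ (Star (Adj plane)) (strictlyInverseʳ u) (strictlyInverseʳ v)
      (walk-to-origin (to u) ◅◅ reverse (λ {a} {b} → adj-sym plane a b) (walk-to-origin (to v)))

-- Deciding the game

∃-dec-finite : ∀ {A : Set} {P : A → Set} (xs : List A) → (∀ a → a ∈ˡ xs) → (∀ a → Dec (P a)) → Dec (∃ P)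
∃-dec-finite xs complete P? with ListAny.any? P? xs
... | yes some = yes (_ , proj₂ (ListAny.satisfied some))
... | no  none = no λ (a , pa) → none (ListAny.map (λ { refl → pa }) (complete a))

module Counting {A : Set} where

  count : {P : A → Set} → (∀ x → Dec (P x)) → List A → ℕ
  count P? []       = 0
  count P? (x ∷ xs) with P? x
  ... | yes _ = suc (count P? xs)
  ... | no  _ = count P? xs

  count≤length : ∀ {P : A → Set} (P? : ∀ x → Dec (P x)) xs → count P? xs ≤ List.length xs
  count≤length P? []       = z≤n
  count≤length P? (x ∷ xs) with P? x
  ... | yes _ = s≤s (count≤length P? xs)
  ... | no  _ = m≤n⇒m≤1+n (count≤length P? xs)

  count-mono : ∀ {P Q : A → Set} (P? : ∀ x → Dec (P x)) (Q? : ∀ x → Dec (Q x)) →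
               (∀ {x} → P x → Q x) → ∀ xs → count P? xs ≤ count Q? xs
  count-mono P? Q? P⇒Q []       = z≤n
  count-mono P? Q? P⇒Q (x ∷ xs) with P? x | Q? x
  ... | yes _  | yes _  = s≤s (count-mono P? Q? P⇒Q xs)
  ... | yes px | no ¬qx = ⊥-elim (¬qx (P⇒Q px))
  ... | no _   | yes _  = m≤n⇒m≤1+n (count-mono P? Q? P⇒Q xs)
  ... | no _   | no _   = count-mono P? Q? P⇒Q xs

  count-strict : ∀ {P Q : A → Set} (P? : ∀ x → Dec (P x)) (Q? : ∀ x → Dec (Q x)) →
                 (∀ {x} → P x → Q x) → ∀ {y} xs → y ∈ˡ xs → Q y → ¬ P y → count P? xs < count Q? xs
  count-strict P? Q? P⇒Q (x ∷ xs) (here refl) qy ¬py with P? x | Q? x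
  ... | yes py | _     = ⊥-elim (¬py py)
  ... | no _   | no ¬q = ⊥-elim (¬q qy)
  ... | no _   | yes _ = s≤s (count-mono P? Q? P⇒Q xs)
  count-strict P? Q? P⇒Q (x ∷ xs) (there y∈xs) qy ¬py with P? x | Q? x
  ... | yes _  | yes _  = s≤s (count-strict P? Q? P⇒Q xs y∈xs qy ¬py)
  ... | yes px | no ¬qx = ⊥-elim (¬qx (P⇒Q px))
  ... | no _   | yes _  = m≤n⇒m≤1+n (count-strict P? Q? P⇒Q xs y∈xs qy ¬py)
  ... | no _   | no _   = count-strict P? Q? P⇒Q xs y∈xs qy ¬py

-- stays-stable holds when P (suc t) = F (P t) for a monotone F.
module Stabilisation {A : Set} (xs : List A) (complete : ∀ a → a ∈ˡ xs)
                     (P : ℕ → A → Set) (P? : ∀ t a → Dec (P t a))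
                     (grow : ∀ t {a} → P t a → P (suc t) a)
                     (stays-stable : ∀ t → (∀ {a} → P (suc t) a → P t a) → ∀ {a} → P (2 + t) a → P (suc t) a) where
  open Counting

  Stable : ℕ → Set
  Stable t = ∀ {a} → P (suc t) a → P t a

  stable-forever : ∀ {t} → Stable t → ∀ k {a} → P (t + k) a → P t a
  stable-forever {t} stable zero    rewrite +-identityʳ t = λ pa → pa
  stable-forever {t} stable (suc k) rewrite +-suc t k     = stable-forever stable k ∘ stable-at k
    where
    stable-at : ∀ k → Stable (t + k)
    stable-at zero    rewrite +-identityʳ t = stable
    stable-at (suc k) rewrite +-suc t k     = stays-stable (t + k) (stable-at k)

  grow-by : ∀ t k {a} → P t a → P (t + k) a
  grow-by t zero    rewrite +-identityʳ t = λ pa → pa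
  grow-by t (suc k) rewrite +-suc t k     = grow (t + k) ∘ grow-by t k

  grow-to : ∀ {t t′} → t ≤ t′ → ∀ {a} → P t a → P t′ a
  grow-to {t} t≤t′ pa = subst (λ s → P s _) (m+[n∸m]≡n t≤t′) (grow-by t _ pa)

  counts-or-stable : ∀ t → (∃[ t′ ] (t′ < t × Stable t′)) ⊎ t ≤ count (P? t) xs
  counts-or-stable zero = inj₂ z≤n
  counts-or-stable (suc t) with counts-or-stable t
  ... | inj₁ (t′ , t′<t , stable) = inj₁ (t′ , m<n⇒m<1+n t′<t , stable)
  ... | inj₂ t≤count with ∃-dec-finite xs complete (λ a → P? (suc t) a ×-dec ¬? (P? t a))
  ...   | yes (a , new , ¬old) = inj₂ (<-≤-trans (s≤s t≤count) (count-strict (P? t) (P? (suc t)) (grow t) xs (complete a) new ¬old))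
  ...   | no  nothing-new     = inj₁ (t , n<1+n t , λ {a} new → decidable-stable (P? t a) (λ ¬old → nothing-new (a , new , ¬old)))

  stable-within : ∃[ t ] (t ≤ List.length xs × Stable t)
  stable-within with counts-or-stable (suc (List.length xs))
  ... | inj₁ (t , s≤s t≤n , stable) = t , t≤n , stable
  ... | inj₂ n<count = ⊥-elim (<⇒≱ n<count (count≤length (P? (suc (List.length xs))) xs))

  stabilised : ∀ t {a} → P t a → P (List.length xs) a
  stabilised t {a} pa with stable-within
  ... | t′ , t′≤n , stable with ≤-total t t′
  ...   | inj₁ t≤t′ = grow-to t′≤n (grow-to t≤t′ pa)
  ...   | inj₂ t′≤t = grow-to t′≤n (stable-forever stable (t ∸ t′) (subst (λ s → P s a) (sym (m+[n∸m]≡n t′≤t)) pa))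

∀∃⇒∃∀ : ∀ {n} (P : ℕ → Fin n → Set) → (∀ {t t′} i → t ≤ t′ → P t i → P t′ i) →
        (∀ i → ∃[ t ] P t i) → ∃[ t ] ∀ i → P t i
∀∃⇒∃∀ {zero}  P mono some = 0 , λ ()
∀∃⇒∃∀ {suc n} P mono some with some fzero | ∀∃⇒∃∀ (λ t i → P t (fsuc i)) (mono ∘ fsuc) (some ∘ fsuc)
... | t₀ , p₀ | t , ps = t₀ ⊔ t , λ { fzero → mono fzero (m≤m⊔n t₀ t) p₀ ; (fsuc i) → mono (fsuc i) (m≤n⊔m t₀ t) (ps i) }

module GameDecidable (G : Graph) where

  V : Set
  V = Vertex G

  vectors : ∀ j → List (Vec V j)
  vectors zero    = [] ∷ []
  vectors (suc j) = List.cartesianProductWith _∷_ (List.allFin (order G)) (vectors j)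

  ∈-vectors : ∀ {j} (cs : Vec V j) → cs ∈ˡ vectors j
  ∈-vectors []       = here refl
  ∈-vectors (c ∷ cs) = ∈-cartesianProductWith⁺ _∷_ (∈-allFin c) (∈-vectors cs)

  _∈?_ : ∀ {j} (r : V) (cs : Vec V j) → Dec (r ∈ cs)
  r ∈? cs = Any.any? (r ≟ᶠ_) cs

  module _ {j : ℕ} where

    Position : Set
    Position = Vec V j × V

    positions : List Position
    positions = List.cartesianProductWith _,_ (vectors j) (List.allFin (order G))

    ∈-positions : ∀ x → x ∈ˡ positions
    ∈-positions (cs , r) = ∈-cartesianProductWith⁺ _,_ (∈-vectors cs) (∈-allFin r)

    WinsWithin : ℕ → Vec V j → V → Set
    WinsWithin zero    cs r = r ∈ cs
    WinsWithin (suc t) cs r = r ∈ cs ⊎ ∃[ cs′ ] (CopMove G cs cs′ × (r ∈ cs′ ⊎ (∀ r′ → Step G r r′ → WinsWithin t cs′ r′)))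

    wins-within? : ∀ t cs r → Dec (WinsWithin t cs r)
    wins-within? zero    cs r = r ∈? cs
    wins-within? (suc t) cs r = r ∈? cs ⊎-dec ∃-dec-finite (vectors j) ∈-vectors λ cs′ →
      decidable (step? G) cs cs′ ×-dec (r ∈? cs′ ⊎-dec Fin.all? λ r′ → step? G r r′ →-dec wins-within? t cs′ r′)

    wins-within-mono : ∀ t {t′} → (∀ {cs r} → WinsWithin t cs r → WinsWithin t′ cs r) →
                       ∀ {cs r} → WinsWithin (suc t) cs r → WinsWithin (suc t′) cs r
    wins-within-mono t t⊆t′ (inj₁ r∈cs)                      = inj₁ r∈cs
    wins-within-mono t t⊆t′ (inj₂ (cs′ , moves , inj₁ r∈cs′)) = inj₂ (cs′ , moves , inj₁ r∈cs′)
    wins-within-mono t t⊆t′ (inj₂ (cs′ , moves , inj₂ win))   = inj₂ (cs′ , moves , inj₂ λ r′ step → t⊆t′ (win r′ step))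

    wins-within-suc : ∀ t {cs r} → WinsWithin t cs r → WinsWithin (suc t) cs r
    wins-within-suc zero    = inj₁
    wins-within-suc (suc t) = wins-within-mono t (wins-within-suc t)

    open Stabilisation positions ∈-positions (λ t (cs , r) → WinsWithin t cs r) (λ t (cs , r) → wins-within? t cs r)
                       (λ t → wins-within-suc t) (λ t stable → wins-within-mono (suc t) stable)
      using (stabilised; grow-to)

    wins-within⇒wins : ∀ t {cs r} → WinsWithin t cs r → CopsWinFrom G cs r
    wins-within⇒wins zero    r∈cs                             = caught r∈cs
    wins-within⇒wins (suc t) (inj₁ r∈cs)                      = caught r∈cs
    wins-within⇒wins (suc t) (inj₂ (cs′ , moves , inj₁ r∈cs′)) = move cs′ moves (inj₁ r∈cs′)
    wins-within⇒wins (suc t) (inj₂ (cs′ , moves , inj₂ win))   = move cs′ moves (inj₂ λ r′ step → wins-within⇒wins t (win r′ step))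

    wins⇒wins-within : ∀ {cs r} → CopsWinFrom G cs r → ∃[ t ] WinsWithin t cs r
    wins⇒wins-within (caught r∈cs)                = 0 , r∈cs
    wins⇒wins-within (move cs′ moves (inj₁ r∈cs′)) = 1 , inj₂ (cs′ , moves , inj₁ r∈cs′)
    wins⇒wins-within {r = r} (move cs′ moves (inj₂ win)) with ∀∃⇒∃∀ (λ t r′ → Step G r r′ → WinsWithin t cs′ r′)
      (λ r′ t≤t′ w step → grow-to t≤t′ (w step)) escape-time
      where
      escape-time : ∀ r′ → ∃[ t ] (Step G r r′ → WinsWithin t cs′ r′)
      escape-time r′ with step? G r r′
      ... | yes step = proj₁ (wins⇒wins-within (win r′ step)) , λ _ → proj₂ (wins⇒wins-within (win r′ step))
      ... | no ¬step = 0 , λ step → ⊥-elim (¬step step)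
    ... | t , wins = suc t , inj₂ (cs′ , moves , inj₂ wins)

    cops-win-from? : ∀ cs r → Dec (CopsWinFrom G cs r)
    cops-win-from? cs r with wins-within? (List.length positions) cs r
    ... | yes w = yes (wins-within⇒wins _ w)
    ... | no ¬w = no λ win → ¬w (stabilised _ (proj₂ (wins⇒wins-within win)))

  cops-win? : ∀ j → Dec (CopsWin G j)
  cops-win? j = ∃-dec-finite (vectors j) ∈-vectors λ cs → Fin.all? (cops-win-from? cs)

least-witness : ∀ {P : ℕ → Set} → (∀ n → Dec (P n)) → ∀ {n} → P n → ∃[ m ] (m ≤ n × P m × ∀ k → k < m → ¬ P k)
least-witness {P} P? {n} = <-rec (λ n → P n → ∃[ m ] (m ≤ n × P m × ∀ k → k < m → ¬ P k)) search n
  where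
  search : ∀ n → (∀ {k} → k < n → P k → ∃[ m ] (m ≤ k × P m × ∀ k → k < m → ¬ P k)) →
           P n → ∃[ m ] (m ≤ n × P m × ∀ k → k < m → ¬ P k)
  search n rec pn with anyUpTo? P? n
  ... | no  none = n , ≤-refl , pn , λ k k<n pk → none (k , k<n , pk)
  ... | yes (k , k<n , pk) with rec k<n pk
  ...   | m , m≤k , pm , least = m , ≤-trans m≤k (<⇒≤ k<n) , pm , least

cops-everywhere-win : ∀ G → CopsWin G (order G)
cops-everywhere-win G = allFin (order G) , λ r → caught (∈-allFin⁺ r)

cop-number : ∀ G → ∃[ c ] (CopsWin G c × CopNumberAtLeast G c)
cop-number G with least-witness (GameDecidable.cops-win? G) (cops-everywhere-win G)
... | c , _ , win , least = c , win , least

cop-number≥k⇒k≤winning : ∀ {G k i} → CopNumberAtLeast G k → CopsWin G i → k ≤ i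
cop-number≥k⇒k≤winning {k = k} {i} k≤c win with k ≤? i
... | yes k≤i = k≤i
... | no  k≰i = ⊥-elim (k≤c i (≰⇒> k≰i) win)

square-mono : ∀ {m n} → m ≤ n → m * m ≤ n * n
square-mono m≤n = *-mono-≤ m≤n m≤n

min-order-mono : ∀ {k x y} → x ≤ y → MinOrderAtMost k x → MinOrderAtMost k y
min-order-mono x≤y (G , connected , k≤c , n≤x) = G , connected , k≤c , ≤-trans n≤x x≤y

min-order≤2p² : ∀ {k p} → Prime p → k ≤ p → MinOrderAtMost k (p * p + p * p)
min-order≤2p² {p = zero}  p-prime _ = ⊥-elim (<⇒≱ (prime>1 p-prime) z≤n)
min-order≤2p² {p = suc q} p-prime k≤p =
  plane , plane-connected , cop-number≥ plane-minDegreeGirth5 origin _ k≤p , ≤-refl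
  where open AffinePlane q p-prime

min-order-quadratic : ∀ k → 2 ^ 24 ≤ k → MinOrderAtMost k (2178 * (k * k))
min-order-quadratic k 2²⁴≤k = via-prime (bertrand-weak k 2²⁴≤k)
  where
  via-prime : ∃[ p ] (Prime p × k < p × p ≤ suc (32 * k)) → MinOrderAtMost k (2178 * (k * k))
  via-prime (p , p-prime , k<p , p≤32k+1) = min-order-mono 2p²≤ (min-order≤2p² p-prime (<⇒≤ k<p))
    where
    1≤k : 1 ≤ k
    1≤k = ≤-trans (m^n>0 2 24) 2²⁴≤k
    +k : ∀ k → 32 * k + k ≡ 33 * k
    +k = solve-∀
    p≤33k : p ≤ 33 * k
    p≤33k = ≤-trans p≤32k+1 (≤-trans (≤-reflexive (+-comm 1 (32 * k))) (≤-trans (+-monoʳ-≤ (32 * k) 1≤k) (≤-reflexive (+k k))))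
    twice-square : ∀ k → 33 * k * (33 * k) + 33 * k * (33 * k) ≡ 2178 * (k * k)
    twice-square = solve-∀
    2p²≤ : p * p + p * p ≤ 2178 * (k * k)
    2p²≤ = ≤-trans (+-mono-≤ (square-mono p≤33k) (square-mono p≤33k)) (≤-reflexive (twice-square k))

meyniel⇒min-order-quadratic : Meyniel → ∃[ C ] ∃[ K ] (∀ k → K ≤ k → ScaledMinOrderAtLeast C k (k * k))
meyniel⇒min-order-quadratic (D , meyniel) = D , 0 , λ k _ G connected k≤c →
  let c , (i , i≤c , win) , c²≤Dn = meyniel G connected
  in ≤-trans (square-mono (≤-trans (cop-number≥k⇒k≤winning k≤c win) i≤c)) c²≤Dn

min-order-quadratic⇒meyniel : ∃[ C ] ∃[ K ] (∀ k → K ≤ k → ScaledMinOrderAtLeast C k (k * k)) → Meyniel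
min-order-quadratic⇒meyniel (C , K , bound) = C + K * K , λ G connected →
  let c , win , least = cop-number G
  in c , (c , ≤-refl , win) , c²≤ G connected c least
  where
  c²≤ : ∀ G → Connected G → ∀ c → CopNumberAtLeast G c → c * c ≤ (C + K * K) * order G
  c²≤ G connected c least with K ≤? c
  ... | yes K≤c = ≤-trans (bound c K≤c G connected least) (*-monoˡ-≤ (order G) (m≤m+n C (K * K)))
  ... | no  K≰c = begin
    c * c                 ≤⟨ square-mono (<⇒≤ (≰⇒> K≰c)) ⟩
    K * K                 ≤⟨ m≤m*n (K * K) (order G) {{>-nonZero (proj₁ connected)}} ⟩
    K * K * order G       ≤⟨ *-monoˡ-≤ (order G) (m≤n+m (K * K) C) ⟩
    (C + K * K) * order G ∎
    where open ≤-Reasoning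

theorem3 : (∃[ C ] ∃[ K ] (∀ (k : ℕ) → K ≤ k → MinOrderAtMost k (C * (k * k))))
    × (Meyniel ⇔ (∃[ C ] ∃[ K ] (∀ (k : ℕ) → K ≤ k → ScaledMinOrderAtLeast C k (k * k))))
theorem3 = (2178 , 2 ^ 24 , min-order-quadratic) , mk⇔ meyniel⇒min-order-quadratic min-order-quadratic⇒meyniel
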